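{- For every instance of Unlabeled Pebble Motion on Trees with $n$ nodes and $k$ pebbles, $\mathit{OPT}\le k(n-k)$.
   Context: Unlabeled Pebble Motion on Trees: a tree $T=(V,E)$ with $n=|V|$ nodes; $k$ pebbles initially occupy $k$ distinct nodes; $k$ distinct nodes are targets (may coincide with starting nodes). A move moves one pebble from its current node to an adjacent pebble-free node; a plan is a sequence of moves, feasible if afterwards every pebble is on a target; its length is the number of moves. $\mathit{OPT}$ is the minimum length of a feasible plan. -}

module Defs where

open import Data.Nat using (ℕ; zero; suc; _∸_)
open import Data.Fin using (Fin)
open import Data.Product using (_×_; Σ; ∃; ∃-syntax; _,_)
open import Data.Sum using (_⊎_)
open import Data.List using (List; length)
open import Data.Vec using (_[_]≔_)
open import Data.Fin.Subset using (Subset; _∈_; _∉_; inside; outside)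
import Data.List.Membership.Propositional as LM
open import Relation.Binary.PropositionalEquality using (_≡_)
open import Relation.Binary.Construct.Closure.ReflexiveTransitive using (Star)

Edges : ℕ → Set
Edges n = List (Fin n × Fin n)

Adj : ∀ {n} → Edges n → Fin n → Fin n → Set
Adj es u v = (u , v) LM.∈ es ⊎ (v , u) LM.∈ es

Connected : ∀ {n} → Edges n → Set
Connected {n} es = (u v : Fin n) → Star (Adj es) u v

-- A tree on n nodes: a connected graph with exactly n - 1 edges.
-- (With n - 1 list entries and connectivity, there can be no loops or
-- repeated edges, so this is exactly a tree on the vertex set Fin n.)
IsTree : ∀ {n} → Edges n → Set
IsTree {n} es = Connected es × length es ≡ n ∸ 1

-- Configurations of unlabeled pebbles: the set of occupied nodes.
-- A move takes the pebble at an occupied node u to an adjacent free node v.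
Move : ∀ {n} → Edges n → Subset n → Subset n → Set
Move {n} es S S′ =
  Σ (Fin n) λ u → Σ (Fin n) λ v →
    Adj es u v × u ∈ S × v ∉ S × S′ ≡ ((S [ u ]≔ outside) [ v ]≔ inside)

data Plan {n} (es : Edges n) : ℕ → Subset n → Subset n → Set where
  done : ∀ {S} → Plan es zero S S
  step : ∀ {m S S′ T} → Move es S S′ → Plan es m S′ T → Plan es (suc m) S T

-- Let r = |S ∖ T| = |T ∖ S| and let c be the number of nodes on which S and T
-- agree, so that n = c + 2r.  Walking from a surplus pebble (in S ∖ T) towards a
-- hole (in T ∖ S) and restarting at every further surplus pebble met, one finds
-- a surplus pebble s and a hole t joined by a path whose interior consists of
-- agreement nodes only, hence has at most c nodes.  Pushing pebbles along that
-- path moves a pebble from s onto t in at most c + 1 moves and leaves r - 1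
-- mismatches and c + 2 agreements.  The whole plan therefore has at most
-- (c + 1) + (c + 3) + ... + (c + 2r - 1) = r (r + c) moves, and writing
-- k = r + a and n - k = r + b gives r (r + c) = r (r + a + b) ≤ k (n - k).

module Submission where

open import Defs
open import Data.Nat using (ℕ; zero; suc; _+_; _*_; _∸_; _≤_; _<_; z≤n; s≤s)
open import Data.Nat.Properties
  using (≤-refl; ≤-trans; ≤-reflexive; m≤n⇒m≤1+n; m≤m+n; +-mono-≤; +-suc; suc-injective;
         +-cancelʳ-≡; +-assoc; m+n∸m≡n; m≤n⇒∃[o]m+o≡n; n≮0; 1+n≢0; +-cancelˡ-≡; module ≤-Reasoning)
open import Data.Nat.Tactic.RingSolver using (solve-∀)
open import Data.Fin using (Fin; zero; suc)
open import Data.Fin.Properties using (_≟_)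
open import Data.Fin.Subset
  using (Subset; _∈_; _∉_; _⊆_; inside; outside; _─_; _-_; _∪_; ∁; ∣_∣; Nonempty)
open import Data.Fin.Subset.Properties
  using (_∈?_; nonempty?; Empty-unique; ∣⊥∣≡0; ∣p∣≤n; ⊆-antisym; p─q⊆p; ∣p─q∣≤∣p∣;
         ∪-comm; x∈p∧x∉q⇒x∈p─q; x∈p∧x≢y⇒x∈p-y; x∈p⇒∣p-x∣<∣p∣; x∈p∪q⁻; x∉p⇒x∈∁p)
open import Data.Vec using ([]; _∷_; here; there; lookup; _[_]≔_)
open import Data.Vec.Properties
  using ([]≔-idempotent; []≔-commutes; []≔-lookup; []≔-updates; []≔-minimal; []=-injective;
         []=⇒lookup; lookup⇒[]=; lookup∘update′)
open import Data.List using (List; []; _∷_; length)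
open import Data.List.Relation.Unary.All as All using (All; []; _∷_)
open import Data.List.Relation.Unary.AllPairs using ([]; _∷_)
open import Data.List.Relation.Unary.Unique.Propositional using (Unique)
open import Data.Product using (Σ; ∃; ∃₂; _×_; _,_; proj₁; proj₂; map₁; map₂; uncurry)
open import Data.Sum as Sum using (_⊎_; inj₁; inj₂)
open import Function using (id; _∘_)
open import Level using (Level)
open import Relation.Nullary using (¬_; yes; no; contradiction)
open import Relation.Nullary.Decidable using (decidable-stable)
open import Relation.Unary using (Pred; Decidable)
open import Relation.Binary using (Rel)
open import Relation.Binary.Definitions using (DecidableEquality)
open import Relation.Binary.PropositionalEquality
  using (_≡_; _≢_; refl; sym; trans; cong; cong₂; subst; module ≡-Reasoning)
open import Relation.Binary.Construct.Closure.ReflexiveTransitive using (Star; ε; _◅_)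
open import Relation.Binary.Construct.Closure.Transitive using (TransClosure; [_]; _∷_)

private
  variable
    a ℓ p q : Level
    A : Set a
    n : ℕ

module _ {R : Rel A ℓ} where

  interior : ∀ {x y} → TransClosure R x y → List A
  interior [ _ ]               = []
  interior (_∷_ {y = y} _ w)   = y ∷ interior w

module _ {R : Rel A ℓ} {P : Pred A p} (_≟ᴬ_ : DecidableEquality A) where

  suffixFrom : ∀ {x z} (y : A) (w : TransClosure R x z) → Unique (interior w) → All P (interior w) →
               (Σ (TransClosure R y z) λ w′ → Unique (y ∷ interior w′) × All P (interior w′))
               ⊎ All (y ≢_) (interior w)
  suffixFrom y [ _ ] _ _ = inj₂ []
  suffixFrom y (_∷_ {y = v} _ w) (v∉w ∷ uw) (_ ∷ pw) with y ≟ᴬ v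
  ... | yes refl = inj₁ (w , v∉w ∷ uw , pw)
  ... | no y≢v   = Sum.map id (y≢v ∷_) (suffixFrom y w uw pw)

  shortcut : ∀ {x z} (w : TransClosure R x z) → All P (interior w) →
             Σ (TransClosure R x z) λ w′ → Unique (interior w′) × All P (interior w′)
  shortcut [ r ] _ = [ r ] , [] , []
  shortcut (_∷_ {y = y} r w) (py ∷ pw) with shortcut w pw
  ... | w′ , uw′ , pw′ with suffixFrom y w′ uw′ pw′
  ...   | inj₁ (w″ , uw″ , pw″) = r ∷ w″ , uw″ , py ∷ pw″
  ...   | inj₂ y∉w′             = r ∷ w′ , y∉w′ ∷ uw′ , py ∷ pw′

module _ {R : Rel A ℓ} {P : Pred A p} {Q : Pred A q}
         (P? : Decidable P) (Q? : Decidable Q) (P⇒¬Q : ∀ {x} → P x → ¬ Q x) where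

  Avoiding : Pred A _
  Avoiding z = ¬ P z × ¬ Q z

  CleanWalkToQ : Pred A _
  CleanWalkToQ x = ∃₂ λ y (w : TransClosure R x y) → Q y × All Avoiding (interior w)

  cleanWalk-or-restart : ∀ {x y} → Star R x y → Q y → ¬ Q x →
                         CleanWalkToQ x ⊎ ∃ λ s → P s × CleanWalkToQ s
  cleanWalk-or-restart ε qy ¬qx = contradiction qy ¬qx
  cleanWalk-or-restart (_◅_ {j = z} r rest) qy ¬qx with Q? z | P? z
  ... | yes qz | _    = inj₁ (z , [ r ] , qz , [])
  ... | no ¬qz | yes pz =
    inj₂ (Sum.[ (λ c → z , pz , c) , id ]′ (cleanWalk-or-restart rest qy ¬qz))
  ... | no ¬qz | no ¬pz =
    Sum.map (λ (y , w , qy′ , av) → y , r ∷ w , qy′ , (¬pz , ¬qz) ∷ av) id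
            (cleanWalk-or-restart rest qy ¬qz)

  separatingWalk : ∀ {x y} → Star R x y → P x → Q y → ∃ λ s → P s × CleanWalkToQ s
  separatingWalk walk px qy =
    Sum.[ (λ c → _ , px , c) , id ]′ (cleanWalk-or-restart walk qy (P⇒¬Q px))

shift : Subset n → Fin n → Fin n → Subset n
shift S u v = (S [ u ]≔ outside) [ v ]≔ inside

∈∧∉⇒≢ : ∀ {S : Subset n} {u v} → u ∈ S → v ∉ S → u ≢ v
∈∧∉⇒≢ u∈S v∉S refl = v∉S u∈S

∉⇒lookup≡outside : ∀ {S : Subset n} {u} → u ∉ S → lookup S u ≡ outside
∉⇒lookup≡outside {S = S} {u} u∉S with lookup S u in eq
... | inside  = contradiction (lookup⇒[]= u S eq) u∉S
... | outside = refl

u∈S⇒S[u]≔inside≡S : ∀ {S : Subset n} {u} → u ∈ S → S [ u ]≔ inside ≡ S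
u∈S⇒S[u]≔inside≡S {S = S} {u} u∈S = subst (λ b → S [ u ]≔ b ≡ S) ([]=⇒lookup u∈S) ([]≔-lookup S u)

u∉S⇒S[u]≔outside≡S : ∀ {S : Subset n} {u} → u ∉ S → S [ u ]≔ outside ≡ S
u∉S⇒S[u]≔outside≡S {S = S} {u} u∉S = subst (λ b → S [ u ]≔ b ≡ S) (∉⇒lookup≡outside u∉S) ([]≔-lookup S u)

v∈shift : ∀ (S : Subset n) u v → v ∈ shift S u v
v∈shift S u v = []≔-updates (S [ u ]≔ outside) v

∉⇒∉[]≔ : ∀ {S : Subset n} {i u} b → i ≢ u → i ∉ S → i ∉ S [ u ]≔ b
∉⇒∉[]≔ {S = S} {i} b i≢u i∉S i∈ =
  i∉S (lookup⇒[]= i S (trans (sym (lookup∘update′ i≢u S b)) ([]=⇒lookup i∈)))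

∉⇒∉[]≔outside : ∀ {S : Subset n} {i} u → i ∉ S → i ∉ S [ u ]≔ outside
∉⇒∉[]≔outside {S = _ ∷ S} zero    i∉S (there i∈) = i∉S (there i∈)
∉⇒∉[]≔outside {S = _ ∷ S} (suc u) i∉S here       = i∉S here
∉⇒∉[]≔outside {S = _ ∷ S} (suc u) i∉S (there i∈) = ∉⇒∉[]≔outside u (i∉S ∘ there) i∈

u∉shift : ∀ {S : Subset n} {u v} → u ≢ v → u ∉ shift S u v
u∉shift {S = S} {u} u≢v = ∉⇒∉[]≔ inside u≢v u∉
  where
  u∉ : u ∉ S [ u ]≔ outside
  u∉ u∈ with []=-injective u∈ ([]≔-updates S u)
  ... | ()

∈⇒∈shift : ∀ {S : Subset n} {u v i} → i ≢ u → i ≢ v → i ∈ S → i ∈ shift S u v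
∈⇒∈shift {S = S} {u} {v} {i} i≢u i≢v i∈S = []≔-minimal _ i v i≢v ([]≔-minimal S i u i≢u i∈S)

∉⇒∉shift : ∀ {S : Subset n} {u v i} → i ≢ v → i ∉ S → i ∉ shift S u v
∉⇒∉shift {u = u} i≢v i∉S = ∉⇒∉[]≔ inside i≢v (∉⇒∉[]≔outside u i∉S)

shift-via-vacant : ∀ {S : Subset n} {u w v} → w ∉ S → shift (shift S u w) w v ≡ shift S u v
shift-via-vacant {S = S} {u} {w} {v} w∉S = cong (_[ v ]≔ inside) (begin
  ((S [ u ]≔ outside) [ w ]≔ inside) [ w ]≔ outside  ≡⟨ []≔-idempotent _ w ⟩
  (S [ u ]≔ outside) [ w ]≔ outside                  ≡⟨ u∉S⇒S[u]≔outside≡S (∉⇒∉[]≔outside u w∉S) ⟩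
  S [ u ]≔ outside                                   ∎)
  where open ≡-Reasoning

shift-via-occupied : ∀ {S : Subset n} {u w v} → u ≢ w → w ≢ v → u ≢ v → w ∈ S →
                     shift (shift S w v) u w ≡ shift S u v
shift-via-occupied {n} {S} {u} {w} {v} u≢w w≢v u≢v w∈S = begin
  (((S₀ [ v ]≔ inside) [ u ]≔ outside) [ w ]≔ inside)
    ≡⟨ cong (_[ w ]≔ inside) ([]≔-commutes S₀ v u (u≢v ∘ sym)) ⟩
  (((S₀ [ u ]≔ outside) [ v ]≔ inside) [ w ]≔ inside)
    ≡⟨ []≔-commutes _ v w (w≢v ∘ sym) ⟩
  (((S₀ [ u ]≔ outside) [ w ]≔ inside) [ v ]≔ inside)
    ≡⟨ cong (_[ v ]≔ inside) ([]≔-commutes S₀ u w u≢w) ⟩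
  (((S₀ [ w ]≔ inside) [ u ]≔ outside) [ v ]≔ inside)
    ≡⟨ cong (λ X → (X [ u ]≔ outside) [ v ]≔ inside) ([]≔-idempotent S w) ⟩
  ((S [ w ]≔ inside) [ u ]≔ outside) [ v ]≔ inside
    ≡⟨ cong (λ X → (X [ u ]≔ outside) [ v ]≔ inside) (u∈S⇒S[u]≔inside≡S w∈S) ⟩
  (S [ u ]≔ outside) [ v ]≔ inside
    ∎
  where
  open ≡-Reasoning
  S₀ : Subset n
  S₀ = S [ w ]≔ outside

module _ {es : Edges n} where

  infixr 5 _++ₚ_
  infixl 5 _∷ʳₚ_

  _++ₚ_ : ∀ {m m′ S S′ T} → Plan es m S S′ → Plan es m′ S′ T → Plan es (m + m′) S T
  done       ++ₚ q = q
  step mv p  ++ₚ q = step mv (p ++ₚ q)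

  _∷ʳₚ_ : ∀ {m S S′ T} → Plan es m S S′ → Move es S′ T → Plan es (suc m) S T
  done      ∷ʳₚ mv′ = step mv′ done
  step mv p ∷ʳₚ mv′ = step mv (p ∷ʳₚ mv′)

  move : ∀ {S u v} → Adj es u v → u ∈ S → v ∉ S → Move es S (shift S u v)
  move adj u∈S v∉S = _ , _ , adj , u∈S , v∉S , refl

  pushAlong : ∀ {S s t} (w : TransClosure (Adj es) s t) → s ∈ S → t ∉ S →
              ∃ λ m → m ≤ suc (length (interior w)) × Plan es m S (shift S s t)
  pushAlong [ adj ] s∈S t∉S = 1 , ≤-refl , step (move adj s∈S t∉S) done
  pushAlong {S} {s} {t} (_∷_ {y = w} adj walk) s∈S t∉S with w ∈? S | w ≟ t | s ≟ w
  ... | no w∉S  | yes refl | _        = 1 , s≤s z≤n , step (move adj s∈S w∉S) done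
  ... | no w∉S  | no w≢t   | _        =
    let (m , m≤ , plan) = pushAlong walk (v∈shift S s w) (∉⇒∉shift (w≢t ∘ sym) t∉S)
    in suc m , s≤s m≤ , step (move adj s∈S w∉S) (subst (Plan es m _) (shift-via-vacant w∉S) plan)
  ... | yes w∈S | _        | yes refl =
    let (m , m≤ , plan) = pushAlong walk s∈S t∉S in m , m≤n⇒m≤1+n m≤ , plan
  -- The pebble blocking w is pushed on to t first; then s moves into the vacated w.
  ... | yes w∈S | _        | no s≢w   =
    let s≢t = ∈∧∉⇒≢ s∈S t∉S
        w≢t = ∈∧∉⇒≢ w∈S t∉S
        (m , m≤ , plan) = pushAlong walk w∈S t∉S
        last = move adj (∈⇒∈shift s≢w s≢t s∈S) (u∉shift w≢t)
    in suc m , s≤s m≤ , subst (Plan es (suc m) S) (shift-via-occupied s≢w w≢t s≢t w∈S) (plan ∷ʳₚ last)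

agreement : Subset n → Subset n → Subset n
agreement S T = ∁ ((S ─ T) ∪ (T ─ S))

∣p∪q∣≡∣p∣+∣q─p∣ : ∀ (p q : Subset n) → ∣ p ∪ q ∣ ≡ ∣ p ∣ + ∣ q ─ p ∣
∣p∪q∣≡∣p∣+∣q─p∣ []            []            = refl
∣p∪q∣≡∣p∣+∣q─p∣ (inside  ∷ p) (_       ∷ q) = cong suc (∣p∪q∣≡∣p∣+∣q─p∣ p q)
∣p∪q∣≡∣p∣+∣q─p∣ (outside ∷ p) (outside ∷ q) = ∣p∪q∣≡∣p∣+∣q─p∣ p q
∣p∪q∣≡∣p∣+∣q─p∣ (outside ∷ p) (inside  ∷ q) =
  trans (cong suc (∣p∪q∣≡∣p∣+∣q─p∣ p q)) (sym (+-suc ∣ p ∣ ∣ q ─ p ∣))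

∣agreement∣+∣p─q∣+∣q─p∣≡n : ∀ (p q : Subset n) → ∣ agreement p q ∣ + (∣ p ─ q ∣ + ∣ q ─ p ∣) ≡ n
∣agreement∣+∣p─q∣+∣q─p∣≡n []            []            = refl
∣agreement∣+∣p─q∣+∣q─p∣≡n (inside  ∷ p) (inside  ∷ q) = cong suc (∣agreement∣+∣p─q∣+∣q─p∣≡n p q)
∣agreement∣+∣p─q∣+∣q─p∣≡n (outside ∷ p) (outside ∷ q) = cong suc (∣agreement∣+∣p─q∣+∣q─p∣≡n p q)
∣agreement∣+∣p─q∣+∣q─p∣≡n (inside  ∷ p) (outside ∷ q) =
  trans (+-suc ∣ agreement p q ∣ _) (cong suc (∣agreement∣+∣p─q∣+∣q─p∣≡n p q))
∣agreement∣+∣p─q∣+∣q─p∣≡n (outside ∷ p) (inside  ∷ q) =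
  trans (cong (∣ agreement p q ∣ +_) (+-suc ∣ p ─ q ∣ _))
        (trans (+-suc ∣ agreement p q ∣ _) (cong suc (∣agreement∣+∣p─q∣+∣q─p∣≡n p q)))

x∈p─q⇒x∉q : ∀ (p q : Subset n) {x} → x ∈ p ─ q → x ∉ q
x∈p─q⇒x∉q (_ ∷ p) (outside ∷ q) here         ()
x∈p─q⇒x∉q (_ ∷ p) (_       ∷ q) (there x∈) (there x∈q) = x∈p─q⇒x∉q p q x∈ x∈q

x∈p⇒∣p∣≢0 : ∀ {p : Subset n} {x} → x ∈ p → ∣ p ∣ ≢ 0
x∈p⇒∣p∣≢0 {p = p} {x} x∈p ∣p∣≡0 = n≮0 (subst (∣ p - x ∣ <_) ∣p∣≡0 (x∈p⇒∣p-x∣<∣p∣ x∈p))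

∣p∣≢0⇒nonempty : ∀ {n} (p : Subset n) → ∣ p ∣ ≢ 0 → Nonempty p
∣p∣≢0⇒nonempty {n} p ∣p∣≢0 with nonempty? p
... | yes ne = ne
... | no ¬ne = contradiction (trans (cong ∣_∣ (Empty-unique ¬ne)) (∣⊥∣≡0 n)) ∣p∣≢0

∣p─q∣≡0⇒p⊆q : ∀ (p q : Subset n) → ∣ p ─ q ∣ ≡ 0 → p ⊆ q
∣p─q∣≡0⇒p⊆q p q ∣p─q∣≡0 {x} x∈p =
  decidable-stable (x ∈? q) (λ x∉q → x∈p⇒∣p∣≢0 (x∈p∧x∉q⇒x∈p─q x∈p x∉q) ∣p─q∣≡0)

length≤∣p∣ : ∀ {p : Subset n} {xs} → Unique xs → All (_∈ p) xs → length xs ≤ ∣ p ∣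
length≤∣p∣ []                 []          = z≤n
length≤∣p∣ {p = p} (x∉xs ∷ u) (x∈p ∷ xs⊆p) =
  ≤-trans (s≤s (length≤∣p∣ u (All.zipWith (λ (y≢x , y∈p) → x∈p∧x≢y⇒x∈p-y y∈p y≢x)
                                           (All.map (_∘ sym) x∉xs , xs⊆p))))
          (x∈p⇒∣p-x∣<∣p∣ x∈p)

∣p∣≡∣q∣⇒∣q─p∣≡∣p─q∣ : ∀ (p q : Subset n) → ∣ p ∣ ≡ ∣ q ∣ → ∣ q ─ p ∣ ≡ ∣ p ─ q ∣
∣p∣≡∣q∣⇒∣q─p∣≡∣p─q∣ p q ∣p∣≡∣q∣ = +-cancelˡ-≡ ∣ p ∣ _ _ (begin
  ∣ p ∣ + ∣ q ─ p ∣  ≡⟨ ∣p∪q∣≡∣p∣+∣q─p∣ p q ⟨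
  ∣ p ∪ q ∣          ≡⟨ cong ∣_∣ (∪-comm p q) ⟩
  ∣ q ∪ p ∣          ≡⟨ ∣p∪q∣≡∣p∣+∣q─p∣ q p ⟩
  ∣ q ∣ + ∣ p ─ q ∣  ≡⟨ cong (_+ ∣ p ─ q ∣) ∣p∣≡∣q∣ ⟨
  ∣ p ∣ + ∣ p ─ q ∣  ∎)
  where open ≡-Reasoning

x∈p─q⇒x∉q─p : ∀ (p q : Subset n) {x} → x ∈ p ─ q → x ∉ q ─ p
x∈p─q⇒x∉q─p p q x∈p─q x∈q─p = x∈p─q⇒x∉q q p x∈q─p (p─q⊆p p q x∈p─q)

∉∧∉⇒∈agreement : ∀ (p q : Subset n) {x} → x ∉ p ─ q → x ∉ q ─ p → x ∈ agreement p q
∉∧∉⇒∈agreement p q x∉p─q x∉q─p = x∉p⇒x∈∁p (Sum.[ x∉p─q , x∉q─p ]′ ∘ x∈p∪q⁻ (p ─ q) (q ─ p))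

─-remove : ∀ {S T : Subset n} {s} → s ∈ S → s ∉ T →
           ∣ S ─ T ∣ ≡ suc ∣ (S [ s ]≔ outside) ─ T ∣ × ∣ T ─ (S [ s ]≔ outside) ∣ ≡ ∣ T ─ S ∣
─-remove {T = outside ∷ T} here s∉T = refl , refl
─-remove {T = inside  ∷ T} here s∉T = contradiction here s∉T
─-remove {S = inside  ∷ S} {outside ∷ T} (there s∈S) s∉T = map₁ (cong suc) (─-remove s∈S (s∉T ∘ there))
─-remove {S = inside  ∷ S} {inside  ∷ T} (there s∈S) s∉T = ─-remove s∈S (s∉T ∘ there)
─-remove {S = outside ∷ S} {outside ∷ T} (there s∈S) s∉T = ─-remove s∈S (s∉T ∘ there)
─-remove {S = outside ∷ S} {inside  ∷ T} (there s∈S) s∉T = map₂ (cong suc) (─-remove s∈S (s∉T ∘ there))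

─-insert : ∀ {S T : Subset n} {t} → t ∉ S → t ∈ T →
           ∣ T ─ S ∣ ≡ suc ∣ T ─ (S [ t ]≔ inside) ∣ × ∣ (S [ t ]≔ inside) ─ T ∣ ≡ ∣ S ─ T ∣
─-insert {S = outside ∷ S} t∉S here = refl , refl
─-insert {S = inside  ∷ S} t∉S here = contradiction here t∉S
─-insert {S = outside ∷ S} {inside  ∷ T} t∉S (there t∈T) = map₁ (cong suc) (─-insert (t∉S ∘ there) t∈T)
─-insert {S = outside ∷ S} {outside ∷ T} t∉S (there t∈T) = ─-insert (t∉S ∘ there) t∈T
─-insert {S = inside  ∷ S} {inside  ∷ T} t∉S (there t∈T) = ─-insert (t∉S ∘ there) t∈T
─-insert {S = inside  ∷ S} {outside ∷ T} t∉S (there t∈T) = map₂ (cong suc) (─-insert (t∉S ∘ there) t∈T)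

shift-─ : ∀ {S T : Subset n} {s t} → s ∈ S ─ T → t ∈ T ─ S →
          ∣ S ─ T ∣ ≡ suc ∣ shift S s t ─ T ∣ × ∣ T ─ S ∣ ≡ suc ∣ T ─ shift S s t ∣
shift-─ {S = S} {T} {s} {t} s∈S─T t∈T─S
  with ─-remove (p─q⊆p S T s∈S─T) (x∈p─q⇒x∉q S T s∈S─T)
     | ─-insert (∉⇒∉[]≔outside s (x∈p─q⇒x∉q T S t∈T─S)) (p─q⊆p T S t∈T─S)
... | removed₁ , removed₂ | inserted₁ , inserted₂ =
  trans removed₁ (cong suc (sym inserted₂)) , trans (sym removed₂) inserted₁

shift-agreement : ∀ {S T : Subset n} {s t} → s ∈ S ─ T → t ∈ T ─ S →
                  ∣ agreement (shift S s t) T ∣ ≡ 2 + ∣ agreement S T ∣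
shift-agreement {n} {S} {T} {s} {t} s∈S─T t∈T─S =
  +-cancelʳ-≡ (d + e) _ _ (begin
    ∣ agreement S′ T ∣ + (d + e)           ≡⟨ ∣agreement∣+∣p─q∣+∣q─p∣≡n S′ T ⟩
    n                                      ≡⟨ sym (∣agreement∣+∣p─q∣+∣q─p∣≡n S T) ⟩
    c + (∣ S ─ T ∣ + ∣ T ─ S ∣)            ≡⟨ cong₂ (λ x y → c + (x + y)) d-eq e-eq ⟩
    c + (suc d + suc e)                    ≡⟨ two-from-sucs c d e ⟩
    2 + c + (d + e)                        ∎)
  where
  open ≡-Reasoning
  S′ : Subset n
  S′ = shift S s t
  c d e : ℕ
  c = ∣ agreement S T ∣
  d = ∣ S′ ─ T ∣
  e = ∣ T ─ S′ ∣
  d-eq : ∣ S ─ T ∣ ≡ suc d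
  d-eq = proj₁ (shift-─ s∈S─T t∈T─S)
  e-eq : ∣ T ─ S ∣ ≡ suc e
  e-eq = proj₂ (shift-─ s∈S─T t∈T─S)
  two-from-sucs : ∀ c d e → c + (suc d + suc e) ≡ 2 + c + (d + e)
  two-from-sucs = solve-∀

cost-recurrence : ∀ r c → suc c + r * (r + (2 + c)) ≡ suc r * (suc r + c)
cost-recurrence = solve-∀

r[r+c]≤k[n∸k] : ∀ {r c k n} → n ≡ c + (r + r) → r ≤ k → k + r ≤ n → r * (r + c) ≤ k * (n ∸ k)
r[r+c]≤k[n∸k] {r} {c} {k} {n} n≡c+2r r≤k k+r≤n with m≤n⇒∃[o]m+o≡n r≤k | m≤n⇒∃[o]m+o≡n k+r≤n
... | a , refl | b , refl = begin
  r * (r + c)              ≡⟨ cong (λ x → r * (r + x)) c≡a+b ⟩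
  r * (r + (a + b))        ≤⟨ m≤m+n _ (a * b) ⟩
  r * (r + (a + b)) + a * b ≡⟨ expand r a b ⟩
  (r + a) * (r + b)        ≡⟨ cong ((r + a) *_) (sym n∸k≡r+b) ⟩
  (r + a) * (n ∸ (r + a))  ∎
  where
  open ≤-Reasoning
  c≡a+b : c ≡ a + b
  c≡a+b = +-cancelʳ-≡ (r + r) c (a + b) (trans (sym n≡c+2r) (regroup r a b))
    where
    regroup : ∀ r a b → r + a + r + b ≡ (a + b) + (r + r)
    regroup = solve-∀
  n∸k≡r+b : r + a + r + b ∸ (r + a) ≡ r + b
  n∸k≡r+b = trans (cong (_∸ (r + a)) (+-assoc (r + a) r b)) (m+n∸m≡n (r + a) (r + b))
  expand : ∀ r a b → r * (r + (a + b)) + a * b ≡ (r + a) * (r + b)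
  expand = solve-∀

module _ {es : Edges n} (connected : Connected es) (T : Subset n) where

  pushTowardTarget : ∀ {S s₀ t₀} → s₀ ∈ S ─ T → t₀ ∈ T ─ S →
    ∃₂ λ s t → s ∈ S ─ T × t ∈ T ─ S ×
      ∃ λ m → m ≤ suc ∣ agreement S T ∣ × Plan es m S (shift S s t)
  pushTowardTarget {S} {s₀} {t₀} s₀∈ t₀∈
    with separatingWalk (_∈? S ─ T) (_∈? T ─ S) (x∈p─q⇒x∉q─p S T) (connected s₀ t₀) s₀∈ t₀∈
  ... | s , s∈ , t , w , t∈ , avoiding
    with shortcut _≟_ w (All.map (uncurry (∉∧∉⇒∈agreement S T)) avoiding)
  ... | w′ , unique , inAgreement
    with pushAlong w′ (p─q⊆p S T s∈) (x∈p─q⇒x∉q T S t∈)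
  ... | m , m≤ , plan =
    s , t , s∈ , t∈ , m , ≤-trans m≤ (s≤s (length≤∣p∣ unique inAgreement)) , plan

  planWithin : ∀ r (S : Subset n) → ∣ S ─ T ∣ ≡ r → ∣ T ─ S ∣ ≡ r →
               ∃ λ m → m ≤ r * (r + ∣ agreement S T ∣) × Plan es m S T
  planWithin zero S d≡0 e≡0 =
    0 , z≤n , subst (Plan es 0 S) (⊆-antisym (∣p─q∣≡0⇒p⊆q S T d≡0) (∣p─q∣≡0⇒p⊆q T S e≡0)) done
  planWithin (suc r) S d≡ e≡
    with pushTowardTarget (proj₂ (∣p∣≢0⇒nonempty (S ─ T) (1+n≢0 ∘ trans (sym d≡))))
                          (proj₂ (∣p∣≢0⇒nonempty (T ─ S) (1+n≢0 ∘ trans (sym e≡))))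
  ... | s , t , s∈ , t∈ , m₁ , m₁≤ , plan₁
    with shift-─ s∈ t∈
  ... | d′ , e′
    with planWithin r (shift S s t) (suc-injective (trans (sym d′) d≡)) (suc-injective (trans (sym e′) e≡))
  ... | m₂ , m₂≤ , plan₂ = m₁ + m₂ , bound , plan₁ ++ₚ plan₂
    where
    bound : m₁ + m₂ ≤ suc r * (suc r + ∣ agreement S T ∣)
    bound = ≤-trans (+-mono-≤ m₁≤ (subst (λ c → m₂ ≤ r * (r + c)) (shift-agreement s∈ t∈) m₂≤))
                    (≤-reflexive (cost-recurrence r _))

mainTheorem11 : (n k : ℕ) (es : Edges n) → IsTree es →
    (S T : Subset n) → ∣ S ∣ ≡ k → ∣ T ∣ ≡ k →
    ∃ λ m → m ≤ k * (n ∸ k) × Plan es m S T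
mainTheorem11 n k es (connected , _) S T ∣S∣≡k ∣T∣≡k =
  let (m , m≤ , plan) = planWithin connected T ∣ S ─ T ∣ S refl balanced
  in m , ≤-trans m≤ (r[r+c]≤k[n∸k] n≡c+2r r≤k k+r≤n) , plan
  where
  balanced : ∣ T ─ S ∣ ≡ ∣ S ─ T ∣
  balanced = ∣p∣≡∣q∣⇒∣q─p∣≡∣p─q∣ S T (trans ∣S∣≡k (sym ∣T∣≡k))
  n≡c+2r : n ≡ ∣ agreement S T ∣ + (∣ S ─ T ∣ + ∣ S ─ T ∣)
  n≡c+2r = trans (sym (∣agreement∣+∣p─q∣+∣q─p∣≡n S T)) (cong (λ e → ∣ agreement S T ∣ + (∣ S ─ T ∣ + e)) balanced)
  r≤k : ∣ S ─ T ∣ ≤ k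
  r≤k = subst (_ ≤_) ∣S∣≡k (∣p─q∣≤∣p∣ S T)
  k+r≤n : k + ∣ S ─ T ∣ ≤ n
  k+r≤n = subst (_≤ n) (trans (∣p∪q∣≡∣p∣+∣q─p∣ T S) (cong (_+ _) ∣T∣≡k)) (∣p∣≤n (T ∪ S))
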